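{- Let $\diamond$ be one of the binary operations join ($\sqcup$), disjoint join, joint join, meet ($\sqcap$), or delta. Then there exist, for each positive integer $m$, a finite ground set $U_m$ with $|U_m|=O(m)$, a total order $<_m$ on $U_m$, and families $\mathcal{F}_m,\mathcal{G}_m$ of subsets of $U_m$ such that $Z_{<_m}(\mathcal{F}_m)+Z_{<_m}(\mathcal{G}_m)=O(m^3)$ and $Z_{<_m}(\mathcal{F}_m\diamond\mathcal{G}_m)=\Omega(2^{m/5}/m)$.
   Context: A family of sets is a set of subsets of a finite ground set $U$. Operations on families $\mathcal{F},\mathcal{G}$: join $\mathcal{F}\sqcup\mathcal{G}=\{F\cup G\mid F\in\mathcal{F},G\in\mathcal{G}\}$; disjoint join $=\{F\cup G\mid F\in\mathcal{F},G\in\mathcal{G},F\cap G=\emptyset\}$; joint join $=\{F\cup G\mid F\in\mathcal{F},G\in\mathcal{G},F\cap G\neq\emptyset\}$; meet $\mathcal{F}\sqcap\mathcal{G}=\{F\cap G\mid F\in\mathcal{F},G\in\mathcal{G}\}$; delta $=\{F\oplus G\mid F\in\mathcal{F},G\in\mathcal{G}\}$ where $\oplus$ is symmetric difference of sets. A zero-suppressed binary decision diagram (ZDD) with respect to a total order $<$ on $U$ is a rooted DAG with two terminal nodes $\top,\bot$ (no outgoing arcs) and internal nodes $\mathtt{n}$, each having a label $\mathsf{lb}(\mathtt{n})\in U$ and two children $\mathsf{lo}(\mathtt{n}),\mathsf{hi}(\mathtt{n})$, such that $\mathsf{lb}(\mathtt{n})<\mathsf{lb}(\mathtt{c})$ for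 every internal child $\mathtt{c}$ of $\mathtt{n}$. The family represented by a node is: $\{\emptyset\}$ for $\top$, $\emptyset$ for $\bot$, and $\mathcal{F}_{\mathsf{lo}(\mathtt{n})}\cup\{\{\mathsf{lb}(\mathtt{n})\}\cup S\mid S\in\mathcal{F}_{\mathsf{hi}(\mathtt{n})}\}$ for an internal node; the ZDD represents the family of its root. The reduced ZDD of a family is the one obtained by repeatedly merging nodes with identical label, lo-child and hi-child, and deleting nodes whose hi-child is $\bot$ (redirecting incoming arcs to their lo-child); it is the unique smallest ZDD representing the family for the given order. $Z_<(\mathcal{F})$ denotes the number of nodes of the reduced ZDD of $\mathcal{F}$ with respect to $<$. Asymptotic notation is as $m\to\infty$. -}

module Defs where

open import Level using (0ℓ)
open import Data.Nat using (ℕ; _+_)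
open import Data.Fin using (Fin; _<_)
open import Data.Fin.Subset using (Subset; _∪_; _∩_; ⁅_⁆) renaming (⊥ to ∅)
open import Data.Bool using (_xor_)
open import Data.Vec using (zipWith)
open import Data.Product using (Σ; ∃-syntax; _×_)
open import Relation.Binary.PropositionalEquality using (_≡_; _≢_)
open import Relation.Unary using (Pred)

-- A family of sets over the ground set Fin n (ground set with its natural total order).
Family : ℕ → Set₁
Family n = Pred (Subset n) 0ℓ

_⊕_ : ∀ {n} → Subset n → Subset n → Subset n
_⊕_ = zipWith _xor_

data Op : Set where
  join disjointJoin jointJoin meet delta : Op

apply : ∀ {n} → Op → Family n → Family n → Family n
apply join         F G S = ∃[ A ] ∃[ B ] (F A × G B × S ≡ A ∪ B)
apply disjointJoin F G S = ∃[ A ] ∃[ B ] (F A × G B × A ∩ B ≡ ∅ × S ≡ A ∪ B)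
apply jointJoin    F G S = ∃[ A ] ∃[ B ] (F A × G B × A ∩ B ≢ ∅ × S ≡ A ∪ B)
apply meet         F G S = ∃[ A ] ∃[ B ] (F A × G B × S ≡ A ∩ B)
apply delta        F G S = ∃[ A ] ∃[ B ] (F A × G B × S ≡ A ⊕ B)

data Ptr (k : ℕ) : Set where
  top bot : Ptr k
  nd      : Fin k → Ptr k

record ZDD (n : ℕ) : Set where
  field
    k      : ℕ
    lb     : Fin k → Fin n
    lo hi  : Fin k → Ptr k
    lo-ord : ∀ i j → lo i ≡ nd j → lb i < lb j
    hi-ord : ∀ i j → hi i ≡ nd j → lb i < lb j
    root   : Ptr k

size : ∀ {n} → ZDD n → ℕ
size D = ZDD.k D + 2

-- membership of a set in the family represented by a node (inductive form of the recursive definition)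
data InNode {n : ℕ} (D : ZDD n) : Ptr (ZDD.k D) → Subset n → Set where
  in-top : InNode D top ∅
  in-lo  : ∀ i {S} → InNode D (ZDD.lo D i) S → InNode D (nd i) S
  in-hi  : ∀ i {S} → InNode D (ZDD.hi D i) S → InNode D (nd i) (⁅ ZDD.lb D i ⁆ ∪ S)

Represents : ∀ {n} → ZDD n → Family n → Set
Represents D F = ∀ S → (InNode D (ZDD.root D) S → F S) × (F S → InNode D (ZDD.root D) S)

{-# OPTIONS --safe #-}
-- Let m ≥ 1 and M = 2m, and split the 4m variables into two halves of size M.  F consists of the
-- twins {j, M + j} (for meet: their complements) and G is the power set (for delta: the sets of
-- size m − 1).  Each family is recognised by an automaton with at most M + 2 states, and an
-- automaton with s states, run over the n variables in order, unrolls into a ZDD with n·s + 2 nodes.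
-- Conversely, for a ⊆ {0, …, m − 1} and i < m the test set (a ++ ∁a) ++ {i} contains a twin iff
-- i ∈ a, and it lies in F ⋄ G (its complement does, for meet) iff it contains a twin; for delta
-- because a test set has m + 1 elements, so it is A ⊕ B with |A| = 2, |B| = m − 1 only if A ⊆ it.
-- So the prefixes a ++ ∁a are pairwise separated by suffixes and lead to 2^m distinct nodes of any
-- ZDD for F ⋄ G.
module Submission where

open import Defs
open import Data.Nat using (ℕ; _+_; _*_; _^_; _≤_; _/_)
open import Data.Product using (Σ; ∃-syntax; _×_)
open import Data.Nat using (zero; suc; pred; _<_; z≤n; s≤s; z<s; s<s)
import Data.Nat.Properties as ℕ
open import Data.Nat.DivMod using (m/n≤m)
open import Data.Nat.Tactic.RingSolver using (solve-∀)
open import Data.Bool using (Bool; true; false; not; _∨_; if_then_else_)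
open import Data.Bool.Properties using (not-involutive)
open import Data.Fin as Fin using (Fin; toℕ; _↑ˡ_; _↑ʳ_)
open import Data.Fin.Properties
  using (toℕ<n; toℕ-injective; toℕ-↑ˡ; toℕ-↑ʳ; toℕ-fromℕ; toℕ-fromℕ<; toℕ-inject₁; injective⇒≤;
         combine-remQuot; splitAt-↑ˡ; splitAt-↑ʳ; splitAt⁻¹-↑ˡ; splitAt⁻¹-↑ʳ; splitAt-≥)
open import Data.Fin.Subset
  using (Subset; _∈_; _∉_; _⊆_; _∪_; _∩_; _─_; ∁; ⁅_⁆; ∣_∣; Nonempty) renaming (⊥ to ∅)
open import Data.Fin.Subset.Properties
  using (⊆-antisym; drop-∷-⊆; in⊆in; out⊆; p⊆p∪q; p∩q⊆p; p⊆q⇒∁p⊇∁q; ∩-comm; ∪-identityˡ; ∪-identityʳ;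
         x∈⁅x⁆; x∈⁅y⁆⇒x≡y; ∉⊥; x∈p∪q⁻; x∈p∪q⁺; x∈p∩q⁺; ∣⁅x⁆∣≡1; ∣∁p∣≡n∸∣p∣; ∣p∣≤n; ∣p∩q∣≤∣p∣)
open import Data.Vec using ([]; _∷_; _++_; lookup; here; there; _[_]≔_; head; tail)
open import Data.Vec.Properties using ([]=⇒lookup; lookup⇒[]=; lookup-++ˡ; ∷-injective; zipWith-++; map-++)
open import Data.Maybe using (Maybe; just; nothing)
open import Data.Product using (_,_; proj₁; proj₂; Σ-syntax; uncurry)
open import Data.Sum using (inj₁; inj₂; [_,_]′)
open import Data.Unit using (⊤)
open import Function using (_∘_; id)
open import Function.Bundles using (_⇔_; mk⇔; Equivalence)
open import Function.Properties.Equivalence using (⇔-isEquivalence; ⇔-setoid)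
open import Level using (0ℓ)
open import Relation.Binary.PropositionalEquality
import Relation.Binary.Reasoning.Setoid as SetoidReasoning
open import Relation.Binary.Structures using (IsEquivalence)
open import Relation.Nullary using (contradiction; yes; no)

open IsEquivalence (⇔-isEquivalence {0ℓ}) using ()
  renaming (refl to ⇔-refl; sym to ⇔-sym; trans to ⇔-trans)

private variable
  n l r m : ℕ
  p q : Subset n

∁-involutive : (p : Subset n) → ∁ (∁ p) ≡ p
∁-involutive []          = refl
∁-involutive (true ∷ p)  = cong (true ∷_) (∁-involutive p)
∁-involutive (false ∷ p) = cong (false ∷_) (∁-involutive p)

⊕-cancelˡ : (p q : Subset n) → p ⊕ (p ⊕ q) ≡ q
⊕-cancelˡ []          []      = refl
⊕-cancelˡ (true ∷ p)  (b ∷ q) = cong₂ _∷_ (not-involutive b) (⊕-cancelˡ p q)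
⊕-cancelˡ (false ∷ p) (b ∷ q) = cong (b ∷_) (⊕-cancelˡ p q)

p⊆q⇒p∪q≡q : p ⊆ q → p ∪ q ≡ q
p⊆q⇒p∪q≡q {p = []}        {[]}        _   = refl
p⊆q⇒p∪q≡q {p = true ∷ p}  {true ∷ q}  p⊆q = cong (true ∷_) (p⊆q⇒p∪q≡q (drop-∷-⊆ p⊆q))
p⊆q⇒p∪q≡q {p = true ∷ p}  {false ∷ q} p⊆q = contradiction (p⊆q here) λ ()
p⊆q⇒p∪q≡q {p = false ∷ p} {b ∷ q}     p⊆q = cong (b ∷_) (p⊆q⇒p∪q≡q (drop-∷-⊆ p⊆q))

p⊆q⇒p∩q≡p : p ⊆ q → p ∩ q ≡ p
p⊆q⇒p∩q≡p {p = []}        {[]}        _   = refl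
p⊆q⇒p∩q≡p {p = true ∷ p}  {true ∷ q}  p⊆q = cong (true ∷_) (p⊆q⇒p∩q≡p (drop-∷-⊆ p⊆q))
p⊆q⇒p∩q≡p {p = true ∷ p}  {false ∷ q} p⊆q = contradiction (p⊆q here) λ ()
p⊆q⇒p∩q≡p {p = false ∷ p} {b ∷ q}     p⊆q = cong (false ∷_) (p⊆q⇒p∩q≡p (drop-∷-⊆ p⊆q))

p⊆q⇒p∪[q─p]≡q : p ⊆ q → p ∪ (q ─ p) ≡ q
p⊆q⇒p∪[q─p]≡q {p = []}        {[]}        _   = refl
p⊆q⇒p∪[q─p]≡q {p = true ∷ p}  {true ∷ q}  p⊆q = cong (true ∷_) (p⊆q⇒p∪[q─p]≡q (drop-∷-⊆ p⊆q))
p⊆q⇒p∪[q─p]≡q {p = true ∷ p}  {false ∷ q} p⊆q = contradiction (p⊆q here) λ ()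
p⊆q⇒p∪[q─p]≡q {p = false ∷ p} {b ∷ q}     p⊆q = cong (b ∷_) (p⊆q⇒p∪[q─p]≡q (drop-∷-⊆ p⊆q))

p∩[q─p]≡∅ : (p q : Subset n) → p ∩ (q ─ p) ≡ ∅
p∩[q─p]≡∅ []          []      = refl
p∩[q─p]≡∅ (true ∷ p)  (b ∷ q) = cong (false ∷_) (p∩[q─p]≡∅ p q)
p∩[q─p]≡∅ (false ∷ p) (b ∷ q) = cong (false ∷_) (p∩[q─p]≡∅ p q)

∣p∩q∣≡∣p∣⇒p⊆q : (p q : Subset n) → ∣ p ∩ q ∣ ≡ ∣ p ∣ → p ⊆ q
∣p∩q∣≡∣p∣⇒p⊆q (true ∷ p)  (true ∷ q)  eq = in⊆in (∣p∩q∣≡∣p∣⇒p⊆q p q (ℕ.suc-injective eq))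
∣p∩q∣≡∣p∣⇒p⊆q (true ∷ p)  (false ∷ q) eq =
  contradiction (∣p∩q∣≤∣p∣ p q) (ℕ.<⇒≱ (ℕ.≤-reflexive (sym eq)))
∣p∩q∣≡∣p∣⇒p⊆q (false ∷ p) (b ∷ q)     eq = out⊆ (∣p∩q∣≡∣p∣⇒p⊆q p q eq)

∣p⊕q∣+2∣p∩q∣≡∣p∣+∣q∣ : (p q : Subset n) → ∣ p ⊕ q ∣ + 2 * ∣ p ∩ q ∣ ≡ ∣ p ∣ + ∣ q ∣
∣p⊕q∣+2∣p∩q∣≡∣p∣+∣q∣ []          []          = refl
∣p⊕q∣+2∣p∩q∣≡∣p∣+∣q∣ (true ∷ p)  (true ∷ q)  = begin
  ∣ p ⊕ q ∣ + 2 * suc ∣ p ∩ q ∣      ≡⟨ two-more ∣ p ⊕ q ∣ ∣ p ∩ q ∣ ⟩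
  2 + (∣ p ⊕ q ∣ + 2 * ∣ p ∩ q ∣)    ≡⟨ cong (2 +_) (∣p⊕q∣+2∣p∩q∣≡∣p∣+∣q∣ p q) ⟩
  2 + (∣ p ∣ + ∣ q ∣)                ≡⟨ cong suc (ℕ.+-suc ∣ p ∣ ∣ q ∣) ⟨
  suc ∣ p ∣ + suc ∣ q ∣              ∎
  where
    open ≡-Reasoning
    two-more : ∀ x c → x + 2 * suc c ≡ 2 + (x + 2 * c)
    two-more = solve-∀
∣p⊕q∣+2∣p∩q∣≡∣p∣+∣q∣ (true ∷ p)  (false ∷ q) = cong suc (∣p⊕q∣+2∣p∩q∣≡∣p∣+∣q∣ p q)
∣p⊕q∣+2∣p∩q∣≡∣p∣+∣q∣ (false ∷ p) (true ∷ q)  =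
  trans (cong suc (∣p⊕q∣+2∣p∩q∣≡∣p∣+∣q∣ p q)) (sym (ℕ.+-suc ∣ p ∣ ∣ q ∣))
∣p⊕q∣+2∣p∩q∣≡∣p∣+∣q∣ (false ∷ p) (false ∷ q) = ∣p⊕q∣+2∣p∩q∣≡∣p∣+∣q∣ p q

∣p++q∣≡∣p∣+∣q∣ : (p : Subset l) (q : Subset r) → ∣ p ++ q ∣ ≡ ∣ p ∣ + ∣ q ∣
∣p++q∣≡∣p∣+∣q∣ []          q = refl
∣p++q∣≡∣p∣+∣q∣ (true ∷ p)  q = cong suc (∣p++q∣≡∣p∣+∣q∣ p q)
∣p++q∣≡∣p∣+∣q∣ (false ∷ p) q = ∣p++q∣≡∣p∣+∣q∣ p q

∣p∣+∣∁p∣≡n : (p : Subset n) → ∣ p ∣ + ∣ ∁ p ∣ ≡ n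
∣p∣+∣∁p∣≡n p = trans (cong (∣ p ∣ +_) (∣∁p∣≡n∸∣p∣ p)) (ℕ.m+[n∸m]≡n (∣p∣≤n p))

++-⊆⁺ : {p p′ : Subset l} {q q′ : Subset r} → p ⊆ p′ → q ⊆ q′ → p ++ q ⊆ p′ ++ q′
++-⊆⁺ {p = []}    {[]}     _    q⊆q′ x∈         = q⊆q′ x∈
++-⊆⁺ {p = _ ∷ _} {_ ∷ _}  p⊆p′ q⊆q′ here       with p⊆p′ here
... | here = here
++-⊆⁺ {p = _ ∷ _} {_ ∷ _}  p⊆p′ q⊆q′ (there x∈) = there (++-⊆⁺ (drop-∷-⊆ p⊆p′) q⊆q′ x∈)

++-⊆⁻ : {p p′ : Subset l} {q q′ : Subset r} → p ++ q ⊆ p′ ++ q′ → p ⊆ p′ × q ⊆ q′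
++-⊆⁻ {p = []}    {[]}    ⊆++ = (λ ()) , ⊆++
++-⊆⁻ {p = _ ∷ p} {_ ∷ p′} {q} {q′} ⊆++ =
  (λ { here → here-++ (⊆++ here) ; (there x∈) → there (proj₁ rest x∈) }) , proj₂ rest
  where
    rest : p ⊆ p′ × q ⊆ q′
    rest = ++-⊆⁻ (drop-∷-⊆ ⊆++)
    here-++ : ∀ {b} {p : Subset l} {q : Subset r} → Fin.zero ∈ b ∷ p ++ q → Fin.zero ∈ b ∷ p
    here-++ here = here

⁅x⁆⊆p⇔x∈p : {x : Fin n} → ⁅ x ⁆ ⊆ p ⇔ x ∈ p
⁅x⁆⊆p⇔x∈p {p = p} {x} = mk⇔ (λ ⁅x⁆⊆p → ⁅x⁆⊆p (x∈⁅x⁆ x))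
                              (λ x∈p {y} y∈⁅x⁆ → subst (_∈ p) (sym (x∈⁅y⁆⇒x≡y x y∈⁅x⁆)) x∈p)

x↑ˡ∈p++q⇔x∈p : {x : Fin l} {p : Subset l} {q : Subset r} → x ↑ˡ r ∈ p ++ q ⇔ x ∈ p
x↑ˡ∈p++q⇔x∈p = mk⇔ to from
  where
    to : {x : Fin l} {p : Subset l} {q : Subset r} → x ↑ˡ r ∈ p ++ q → x ∈ p
    to {x = Fin.zero}  {_ ∷ _} here       = here
    to {x = Fin.suc x} {_ ∷ _} (there x∈) = there (to x∈)
    from : {x : Fin l} {p : Subset l} {q : Subset r} → x ∈ p → x ↑ˡ r ∈ p ++ q
    from here       = here
    from (there x∈) = there (from x∈)

lookup≡false⇒∉ : {x : Fin n} → lookup p x ≡ false → x ∉ p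
lookup≡false⇒∉ px≡false x∈p = contradiction (trans (sym ([]=⇒lookup x∈p)) px≡false) λ ()

x∉p⇒p[x]≔false≡p : {x : Fin n} → x ∉ p → p [ x ]≔ false ≡ p
x∉p⇒p[x]≔false≡p {p = true ∷ p}  {Fin.zero}  x∉p = contradiction here x∉p
x∉p⇒p[x]≔false≡p {p = false ∷ p} {Fin.zero}  x∉p = refl
x∉p⇒p[x]≔false≡p {p = b ∷ p}     {Fin.suc x} x∉p = cong (b ∷_) (x∉p⇒p[x]≔false≡p (x∉p ∘ there))

⁅x⁆∪p[x]≔false≡p : {x : Fin n} → x ∉ p → (⁅ x ⁆ ∪ p) [ x ]≔ false ≡ p
⁅x⁆∪p[x]≔false≡p {p = true ∷ p}  {Fin.zero}  x∉p = contradiction here x∉p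
⁅x⁆∪p[x]≔false≡p {p = false ∷ p} {Fin.zero}  x∉p = cong (false ∷_) (∪-identityˡ p)
⁅x⁆∪p[x]≔false≡p {p = b ∷ p}     {Fin.suc x} x∉p = cong (b ∷_) (⁅x⁆∪p[x]≔false≡p (x∉p ∘ there))

⁅x⁆∪[p[x]≔false]≡p : {x : Fin n} → x ∈ p → ⁅ x ⁆ ∪ (p [ x ]≔ false) ≡ p
⁅x⁆∪[p[x]≔false]≡p {p = true ∷ p} here       = cong (true ∷_) (∪-identityˡ p)
⁅x⁆∪[p[x]≔false]≡p {p = b ∷ p}    (there x∈) = cong (b ∷_) (⁅x⁆∪[p[x]≔false]≡p x∈)

-- Levels and Shannon expansion

module Shannon {n} (D : ZDD n) where
  open ZDD D

  level : Ptr k → ℕ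
  level top    = n
  level bot    = n
  level (nd i) = toℕ (lb i)

  child-above : ∀ i {p} → (∀ j → p ≡ nd j → lb i Fin.< lb j) → toℕ (lb i) < level p
  child-above i {top}  _       = toℕ<n (lb i)
  child-above i {bot}  _       = toℕ<n (lb i)
  child-above i {nd j} ordered = ordered j refl

  level≤element : ∀ {p S x} → InNode D p S → x ∈ S → level p ≤ toℕ x
  level≤element in-top         x∈ = contradiction x∈ ∉⊥
  level≤element (in-lo i d)    x∈ = ℕ.<⇒≤ (ℕ.<-≤-trans (child-above i (lo-ord i)) (level≤element d x∈))
  level≤element (in-hi i {S} d) x∈ with x∈p∪q⁻ ⁅ lb i ⁆ S x∈
  ... | inj₁ x∈⁅lb⁆ = ℕ.≤-reflexive (cong toℕ (sym (x∈⁅y⁆⇒x≡y (lb i) x∈⁅lb⁆)))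
  ... | inj₂ x∈S    = ℕ.<⇒≤ (ℕ.<-≤-trans (child-above i (hi-ord i)) (level≤element d x∈S))

  ∉-below-level : ∀ {p S x} → toℕ x < level p → InNode D p S → x ∉ S
  ∉-below-level x<p d x∈ = ℕ.<⇒≱ x<p (level≤element d x∈)

  data Position (x : Fin n) : Ptr k → Set where
    at    : ∀ i → lb i ≡ x → Position x (nd i)
    below : ∀ {p} → toℕ x < level p → Position x p

  position : ∀ x p → toℕ x ≤ level p → Position x p
  position x top    _   = below (toℕ<n x)
  position x bot    _   = below (toℕ<n x)
  position x (nd i) x≤p with lb i Fin.≟ x
  ... | yes lb≡x = at i lb≡x
  ... | no  lb≢x = below (ℕ.≤∧≢⇒< x≤p (lb≢x ∘ sym ∘ toℕ-injective))

  nd⇔lo : ∀ i {S} → lb i ∉ S → InNode D (nd i) S ⇔ InNode D (lo i) S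
  nd⇔lo i {S} lb∉S = mk⇔ to (in-lo i)
    where
      to : InNode D (nd i) S → InNode D (lo i) S
      to (in-lo _ d) = d
      to (in-hi _ d) = contradiction (x∈p∪q⁺ (inj₁ (x∈⁅x⁆ (lb i)))) lb∉S

  nd⇔hi : ∀ i {S} → lb i ∈ S → InNode D (nd i) S ⇔ InNode D (hi i) (S [ lb i ]≔ false)
  nd⇔hi i {S} lb∈S = mk⇔ to (subst (InNode D (nd i)) (⁅x⁆∪[p[x]≔false]≡p lb∈S) ∘ in-hi i)
    where
      to : InNode D (nd i) S → InNode D (hi i) (S [ lb i ]≔ false)
      to (in-lo _ d) = contradiction lb∈S (∉-below-level (child-above i (lo-ord i)) d)
      to (in-hi _ d) =
        subst (InNode D (hi i)) (sym (⁅x⁆∪p[x]≔false≡p (∉-below-level (child-above i (hi-ord i)) d))) d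

  decide : ∀ x b {p} → toℕ x ≤ level p →
           Σ[ p′ ∈ Ptr k ] toℕ x < level p′ ×
             (∀ {S} → lookup S x ≡ b → InNode D p S ⇔ InNode D p′ (S [ x ]≔ false))
  decide x b {p} x≤p with position x p x≤p
  decide _ false _ | at i refl = lo i , child-above i (lo-ord i) , λ {S} Sx≡false →
    let x∉S = lookup≡false⇒∉ Sx≡false in
    subst (λ S′ → InNode D (nd i) S ⇔ InNode D (lo i) S′) (sym (x∉p⇒p[x]≔false≡p x∉S)) (nd⇔lo i x∉S)
  decide _ true  _ | at i refl = hi i , child-above i (hi-ord i) , λ {S} Sx≡true →
    nd⇔hi i (lookup⇒[]= (lb i) S Sx≡true)
  decide x false {p} _ | below x<p = p , x<p , λ {S} Sx≡false →
    subst (λ S′ → InNode D p S ⇔ InNode D p S′) (sym (x∉p⇒p[x]≔false≡p (lookup≡false⇒∉ Sx≡false)))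
      (mk⇔ id id)
  decide x true  {p} _ | below x<p = bot , toℕ<n x , λ {S} Sx≡true →
    mk⇔ (λ d → contradiction (lookup⇒[]= x S Sx≡true) (∉-below-level x<p d)) λ ()

-- Residual nodes and the fooling-set bound

clearBelow : ℕ → Subset n → Subset n
clearBelow zero    p       = p
clearBelow (suc j) []      = []
clearBelow (suc j) (b ∷ p) = false ∷ clearBelow j p

lookup-clearBelow : ∀ {j} (x : Fin n) (p : Subset n) → toℕ x ≡ j → lookup (clearBelow j p) x ≡ lookup p x
lookup-clearBelow Fin.zero    (b ∷ p) refl = refl
lookup-clearBelow (Fin.suc x) (b ∷ p) refl = lookup-clearBelow x p refl

clearBelow[x]≔false : ∀ {j} (x : Fin n) (p : Subset n) → toℕ x ≡ j →
                      clearBelow j p [ x ]≔ false ≡ clearBelow (suc j) p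
clearBelow[x]≔false Fin.zero    (b ∷ p) refl = refl
clearBelow[x]≔false (Fin.suc x) (b ∷ p) refl = cong (false ∷_) (clearBelow[x]≔false x p refl)

clearBelow-++ : (p : Subset l) (q : Subset r) → clearBelow l (p ++ q) ≡ ∅ ++ q
clearBelow-++ []      q = refl
clearBelow-++ (b ∷ p) q = cong (false ∷_) (clearBelow-++ p q)

module Residual {l r} (D : ZDD (l + r)) where
  open ZDD D
  open Shannon D

  cut-step : ∀ (A : Subset l) (i : Fin l) {j p} → toℕ i ≡ j → j ≤ level p →
             Σ[ p′ ∈ Ptr k ] suc j ≤ level p′ ×
               (∀ B → InNode D p (clearBelow j (A ++ B)) ⇔ InNode D p′ (clearBelow (suc j) (A ++ B)))
  cut-step A i {p = p} refl i≤p =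
    let x≡i = toℕ-↑ˡ i r
        (p′ , x<p′ , p⇔p′) = decide (i ↑ˡ r) (lookup A i) (subst (_≤ level p) (sym x≡i) i≤p)
    in p′ , subst (_< level p′) x≡i x<p′ , λ B →
       subst (λ S → InNode D p (clearBelow (toℕ i) (A ++ B)) ⇔ InNode D p′ S)
             (clearBelow[x]≔false (i ↑ˡ r) (A ++ B) x≡i)
             (p⇔p′ (trans (lookup-clearBelow (i ↑ˡ r) (A ++ B) x≡i) (lookup-++ˡ A B i)))

  cut : ∀ (A : Subset l) j → j ≤ l →
        Σ[ p ∈ Ptr k ] j ≤ level p × (∀ B → InNode D root (A ++ B) ⇔ InNode D p (clearBelow j (A ++ B)))
  cut A zero    _   = root , z≤n , λ _ → ⇔-refl
  cut A (suc j) j<l =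
    let (p , j≤p , root⇔p) = cut A j (ℕ.<⇒≤ j<l)
        (p′ , j<p′ , p⇔p′) = cut-step A (Fin.fromℕ< j<l) (toℕ-fromℕ< j<l) j≤p
    in p′ , j<p′ , λ B → ⇔-trans (root⇔p B) (p⇔p′ B)

  residual : (A : Subset l) → Σ[ p ∈ Ptr k ] (∀ B → InNode D root (A ++ B) ⇔ InNode D p (∅ ++ B))
  residual A =
    let (p , _ , root⇔p) = cut A l ℕ.≤-refl
    in p , λ B → subst (λ S → InNode D root (A ++ B) ⇔ InNode D p S) (clearBelow-++ A B) (root⇔p B)

ptrToFin : ∀ {k} → Ptr k → Fin (2 + k)
ptrToFin top    = Fin.zero
ptrToFin bot    = Fin.suc Fin.zero
ptrToFin (nd i) = Fin.suc (Fin.suc i)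

ptrToFin-injective : ∀ {k} {p q : Ptr k} → ptrToFin p ≡ ptrToFin q → p ≡ q
ptrToFin-injective {p = top}  {top}  _    = refl
ptrToFin-injective {p = bot}  {bot}  _    = refl
ptrToFin-injective {p = nd i} {nd j} refl = refl

isOne : Fin 2 → Bool
isOne Fin.zero    = false
isOne (Fin.suc _) = true

isOne-injective : ∀ {b c} → isOne b ≡ isOne c → b ≡ c
isOne-injective {Fin.zero}          {Fin.zero}          _ = refl
isOne-injective {Fin.suc Fin.zero}  {Fin.suc Fin.zero}  _ = refl

decode : ∀ m → Fin (2 ^ m) → Subset m
decode zero    _ = []
decode (suc m) i = isOne (proj₁ (Fin.remQuot {2} (2 ^ m) i)) ∷ decode m (proj₂ (Fin.remQuot {2} (2 ^ m) i))

decode-injective : ∀ m {i j} → decode m i ≡ decode m j → i ≡ j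
decode-injective zero    {Fin.zero} {Fin.zero} _ = refl
decode-injective (suc m) {i} {j} eq =
  let (head≡ , tail≡) = ∷-injective eq in begin
    i                                               ≡⟨ combine-remQuot {2} (2 ^ m) i ⟨
    uncurry Fin.combine (Fin.remQuot {2} (2 ^ m) i)
      ≡⟨ cong₂ Fin.combine (isOne-injective head≡) (decode-injective m tail≡) ⟩
    uncurry Fin.combine (Fin.remQuot {2} (2 ^ m) j) ≡⟨ combine-remQuot {2} (2 ^ m) j ⟩
    j                                               ∎
  where open ≡-Reasoning

injection⇒2^m≤k+2 : ∀ {m k} (f : Subset m → Ptr k) → (∀ {a b} → f a ≡ f b → a ≡ b) → 2 ^ m ≤ k + 2
injection⇒2^m≤k+2 {m} {k} f f-injective =
  ℕ.≤-trans (injective⇒≤ {f = ptrToFin ∘ f ∘ decode m} (decode-injective m ∘ f-injective ∘ ptrToFin-injective))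
            (ℕ.≤-reflexive (ℕ.+-comm 2 k))

represents⇔ : ∀ {D : ZDD n} {F : Family n} → Represents D F → ∀ S → InNode D (ZDD.root D) S ⇔ F S
represents⇔ rep S = mk⇔ (proj₁ (rep S)) (proj₂ (rep S))

fooling-set-bound : ∀ {m} {H : Family (l + r)} (D : ZDD (l + r)) → Represents D H →
                    (prefix : Subset m → Subset l) (probe : Fin m → Subset r) →
                    (∀ a i → H (prefix a ++ probe i) ⇔ i ∈ a) → 2 ^ m ≤ size D
fooling-set-bound {l} {r} {m} {H} D rep prefix probe probe⇔∈ = injection⇒2^m≤k+2 node node-injective
  where
    open ZDD D
    open Residual {l} {r} D

    node : Subset m → Ptr k
    node a = proj₁ (residual (prefix a))

    same-quotient : ∀ {a b} → node a ≡ node b → ∀ B → H (prefix a ++ B) ⇔ H (prefix b ++ B)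
    same-quotient {a} {b} eq B = begin
      H (prefix a ++ B)                  ≈⟨ represents⇔ rep _ ⟨
      InNode D root (prefix a ++ B)      ≈⟨ proj₂ (residual (prefix a)) B ⟩
      InNode D (node a) (∅ ++ B)         ≡⟨ cong (λ p → InNode D p (∅ ++ B)) eq ⟩
      InNode D (node b) (∅ ++ B)         ≈⟨ proj₂ (residual (prefix b)) B ⟨
      InNode D root (prefix b ++ B)      ≈⟨ represents⇔ rep _ ⟩
      H (prefix b ++ B)                  ∎
      where open SetoidReasoning (⇔-setoid 0ℓ)

    node-injective : ∀ {a b} → node a ≡ node b → a ≡ b
    node-injective {a} {b} eq = ⊆-antisym (Equivalence.to (∈a⇔∈b _)) (Equivalence.from (∈a⇔∈b _))
      where
        ∈a⇔∈b : ∀ i → i ∈ a ⇔ i ∈ b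
        ∈a⇔∈b i = ⇔-trans (⇔-sym (probe⇔∈ a i)) (⇔-trans (same-quotient eq (probe i)) (probe⇔∈ b i))

-- ZDDs unrolled from automata

record DFA (s : ℕ) : Set where
  field
    start     : Fin s
    δ         : Fin s → Bool → Maybe (Fin s)
    accepting : Fin s → Bool

  accepts : Maybe (Fin s) → Subset n → Bool
  accepts nothing  _       = false
  accepts (just q) []      = accepting q
  accepts (just q) (b ∷ V) = accepts (δ q b) V

Language : ∀ {s} → DFA s → Family n
Language A S = DFA.accepts A (just (DFA.start A)) S ≡ true

-- Over r variables there are r layers of s nodes: q ↑ˡ r * s reads variable 0 in state q, and
-- s ↑ʳ i is node i of the ZDD over the last r − 1 variables.
module Layered {s} (A : DFA s) where
  open DFA A

  data Layer (r : ℕ) : Fin (suc r * s) → Set where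
    first : ∀ q → Layer r (q ↑ˡ r * s)
    later : ∀ i → Layer r (s ↑ʳ i)

  layer : ∀ {r} i → Layer r i
  layer {r} i with Fin.splitAt s i in eq
  ... | inj₁ q = subst (Layer r) (splitAt⁻¹-↑ˡ eq) (first q)
  ... | inj₂ j = subst (Layer r) (splitAt⁻¹-↑ʳ eq) (later j)

  shift : ∀ {r} → Ptr (r * s) → Ptr (suc r * s)
  shift top    = top
  shift bot    = bot
  shift (nd i) = nd (s ↑ʳ i)

  shift≡nd : ∀ {r} {p : Ptr (r * s)} {j} → shift {r} p ≡ nd j → ∃[ i ] p ≡ nd i × s ↑ʳ i ≡ j
  shift≡nd {p = nd i} refl = i , refl , refl

  entry : ∀ r → Maybe (Fin s) → Ptr (r * s)
  entry r       nothing  = bot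
  entry zero    (just q) = if accepting q then top else bot
  entry (suc r) (just q) = nd (q ↑ˡ r * s)

  label : ∀ r → Fin (r * s) → Fin r
  label (suc r) i = [ (λ _ → Fin.zero) , (λ j → Fin.suc (label r j)) ]′ (Fin.splitAt s i)

  child : ∀ r → Bool → Fin (r * s) → Ptr (r * s)
  child (suc r) b i =
    [ (λ q → shift {r} (entry r (δ q b))) , (λ j → shift {r} (child r b j)) ]′ (Fin.splitAt s i)

  label-first : ∀ {r} q → label (suc r) (q ↑ˡ r * s) ≡ Fin.zero
  label-first {r} q rewrite splitAt-↑ˡ s q (r * s) = refl

  label-later : ∀ {r} i → label (suc r) (s ↑ʳ i) ≡ Fin.suc (label r i)
  label-later {r} i rewrite splitAt-↑ʳ s (r * s) i = refl

  child-first : ∀ {r} q b → child (suc r) b (q ↑ˡ r * s) ≡ shift {r} (entry r (δ q b))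
  child-first {r} q b rewrite splitAt-↑ˡ s q (r * s) = refl

  child-later : ∀ {r} i b → child (suc r) b (s ↑ʳ i) ≡ shift {r} (child r b i)
  child-later {r} i b rewrite splitAt-↑ʳ s (r * s) i = refl

  child-ordered : ∀ r b i j → child r b i ≡ nd j → label r i Fin.< label r j
  child-ordered (suc r) b i j eq with layer {r} i
  ... | first q with shift≡nd {r} {j = j} (trans (sym (child-first {r} q b)) eq)
  ...   | j′ , _ , refl = subst₂ Fin._<_ (sym (label-first {r} q)) (sym (label-later j′)) z<s
  child-ordered (suc r) b i j eq | later i′ with shift≡nd {r} {j = j} (trans (sym (child-later {r} i′ b)) eq)
  ...   | j′ , i′→j′ , refl =
    subst₂ Fin._<_ (sym (label-later i′)) (sym (label-later j′)) (s<s (child-ordered r b i′ j′ i′→j′))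

  zdd : ∀ r → ZDD r
  zdd r = record
    { k = r * s ; lb = label r ; lo = child r false ; hi = child r true
    ; lo-ord = child-ordered r false ; hi-ord = child-ordered r true
    ; root = entry r (just start) }

  module _ {r : ℕ} where
    private
      Z : ZDD r
      Z = zdd r
      Z′ : ZDD (suc r)
      Z′ = zdd (suc r)
    open Shannon Z′ using (nd⇔lo; nd⇔hi)

    shift⁺ : ∀ {p V} → InNode Z p V → InNode Z′ (shift {r} p) (false ∷ V)
    shift⁺ in-top = in-top
    shift⁺ (in-lo i d) = in-lo (s ↑ʳ i) (subst (λ c → InNode Z′ c _) (sym (child-later i false)) (shift⁺ d))
    shift⁺ (in-hi i {S} d) =
      subst (InNode Z′ (nd (s ↑ʳ i))) (cong (λ x → ⁅ x ⁆ ∪ (false ∷ S)) (label-later i))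
        (in-hi (s ↑ʳ i) (subst (λ c → InNode Z′ c _) (sym (child-later i true)) (shift⁺ d)))

    shift⁻ : ∀ {p′ S} → InNode Z′ p′ S → ∀ {p} → p′ ≡ shift {r} p → head S ≡ false × InNode Z p (tail S)
    shift⁻ in-top {top} refl = refl , in-top
    shift⁻ (in-lo _ d) {nd i} refl =
      let (head≡false , d′) = shift⁻ d (child-later i false) in head≡false , in-lo i d′
    shift⁻ (in-hi _ {c ∷ S} d) {nd i} refl =
      let (c≡false , d′) = shift⁻ d (child-later i true) in
      subst (λ x → head (⁅ x ⁆ ∪ (c ∷ S)) ≡ false × InNode Z (nd i) (tail (⁅ x ⁆ ∪ (c ∷ S))))
            (sym (label-later i)) (c≡false , in-hi i d′)

    shift⇔ : ∀ p V → InNode Z′ (shift {r} p) (false ∷ V) ⇔ InNode Z p V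
    shift⇔ p V = mk⇔ (λ d → proj₂ (shift⁻ d refl)) shift⁺

    first-layer⇔ : ∀ q b V →
                   InNode Z′ (nd (q ↑ˡ r * s)) (b ∷ V) ⇔ InNode Z′ (shift {r} (entry r (δ q b))) (false ∷ V)
    first-layer⇔ q false V =
      subst (λ c → InNode Z′ (nd (q ↑ˡ r * s)) (false ∷ V) ⇔ InNode Z′ c (false ∷ V)) (child-first q false)
        (nd⇔lo (q ↑ˡ r * s) (subst (_∉ false ∷ V) (sym (label-first q)) λ ()))
    first-layer⇔ q true  V =
      subst₂ (λ c x → InNode Z′ (nd (q ↑ˡ r * s)) (true ∷ V) ⇔ InNode Z′ c ((true ∷ V) [ x ]≔ false))
        (child-first q true) (label-first q)
        (nd⇔hi (q ↑ˡ r * s) (subst (_∈ true ∷ V) (sym (label-first q)) here))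

  entry-correct : ∀ r mq (V : Subset r) → InNode (zdd r) (entry r mq) V ⇔ accepts mq V ≡ true
  entry-correct r       nothing  V  = mk⇔ (λ ()) (λ ())
  entry-correct zero    (just q) [] with accepting q
  ... | true  = mk⇔ (λ _ → refl) (λ _ → in-top)
  ... | false = mk⇔ (λ ()) (λ ())
  entry-correct (suc r) (just q) (b ∷ V) =
    ⇔-trans (first-layer⇔ q b V) (⇔-trans (shift⇔ _ V) (entry-correct r (δ q b) V))

dfa-represents : ∀ {s} (A : DFA s) → Represents (Layered.zdd A n) (Language A)
dfa-represents {n} A S = Equivalence.to eqv , Equivalence.from eqv
  where
    eqv : InNode (Layered.zdd A n) (ZDD.root (Layered.zdd A n)) S ⇔ Language A S
    eqv = Layered.entry-correct A n (just (DFA.start A)) S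

Represents-cong : ∀ {D : ZDD n} {F G : Family n} → (∀ S → F S ⇔ G S) → Represents D F → Represents D G
Represents-cong F⇔G rep S = Equivalence.to (F⇔G S) ∘ proj₁ (rep S) , proj₂ (rep S) ∘ Equivalence.from (F⇔G S)

record Recognizer (F : Family n) (s : ℕ) : Set where
  field
    states     : ℕ
    dfa        : DFA states
    few-states : states ≤ s
    language   : ∀ S → Language dfa S ⇔ F S

recognizer⇒zdd : ∀ {F : Family n} {s} → Recognizer F s → Σ[ D ∈ ZDD n ] Represents D F × size D ≤ n * s + 2
recognizer⇒zdd {n} R =
  Layered.zdd dfa n , Represents-cong language (dfa-represents dfa) , ℕ.+-monoˡ-≤ 2 (ℕ.*-monoʳ-≤ n few-states)
  where open Recognizer R

Recognizer-weaken : ∀ {F : Family n} {s s′} → s ≤ s′ → Recognizer F s → Recognizer F s′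
Recognizer-weaken s≤s′ R = record { dfa = dfa ; few-states = ℕ.≤-trans few-states s≤s′ ; language = language }
  where open Recognizer R

complementDFA : ∀ {s} → DFA s → DFA s
complementDFA A = record A { δ = λ q b → DFA.δ A q (not b) }

accepts-complementDFA : ∀ {s} (A : DFA s) mq (V : Subset n) →
                        DFA.accepts (complementDFA A) mq V ≡ DFA.accepts A mq (∁ V)
accepts-complementDFA A nothing  V       = refl
accepts-complementDFA A (just q) []      = refl
accepts-complementDFA A (just q) (b ∷ V) = accepts-complementDFA A (DFA.δ A q (not b)) V

complement-recognizer : ∀ {F : Family n} {s} → Recognizer F s → Recognizer (F ∘ ∁) s
complement-recognizer R = record
  { dfa        = complementDFA dfa
  ; few-states = few-states
  ; language   = λ S → subst (λ b → b ≡ true ⇔ _) (sym (accepts-complementDFA dfa (just (DFA.start dfa)) S))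
                             (language (∁ S)) }
  where open Recognizer R

PowerSet : Family n
PowerSet _ = ⊤

OfSize : ℕ → Family n
OfSize t S = ∣ S ∣ ≡ t

twin : ∀ {M} → Fin M → Subset (M + M)
twin j = ⁅ j ⁆ ++ ⁅ j ⁆

Twins : ∀ M → Family (M + M)
Twins M S = Σ[ j ∈ Fin M ] S ≡ twin j

∅++∅ : ∀ l r → ∅ {l} ++ ∅ {r} ≡ ∅
∅++∅ zero    r = refl
∅++∅ (suc l) r = cong (false ∷_) (∅++∅ l r)

⁅i↑ˡn⁆≡⁅i⁆++∅ : ∀ (i : Fin l) r → ⁅ i ↑ˡ r ⁆ ≡ ⁅ i ⁆ ++ ∅ {r}
⁅i↑ˡn⁆≡⁅i⁆++∅ Fin.zero    r = cong (true ∷_) (sym (∅++∅ _ r))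
⁅i↑ˡn⁆≡⁅i⁆++∅ (Fin.suc i) r = cong (false ∷_) (⁅i↑ˡn⁆≡⁅i⁆++∅ i r)

⁅l↑ʳi⁆≡∅++⁅i⁆ : ∀ l (i : Fin r) → ⁅ l ↑ʳ i ⁆ ≡ ∅ {l} ++ ⁅ i ⁆
⁅l↑ʳi⁆≡∅++⁅i⁆ zero    i = refl
⁅l↑ʳi⁆≡∅++⁅i⁆ (suc l) i = cong (false ∷_) (⁅l↑ʳi⁆≡∅++⁅i⁆ l i)

twin≡⁅j↑ˡM⁆∪⁅M↑ʳj⁆ : ∀ {M} (j : Fin M) → twin j ≡ ⁅ j ↑ˡ M ⁆ ∪ ⁅ M ↑ʳ j ⁆
twin≡⁅j↑ˡM⁆∪⁅M↑ʳj⁆ {M} j = sym (begin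
  ⁅ j ↑ˡ M ⁆ ∪ ⁅ M ↑ʳ j ⁆          ≡⟨ cong₂ _∪_ (⁅i↑ˡn⁆≡⁅i⁆++∅ j M) (⁅l↑ʳi⁆≡∅++⁅i⁆ M j) ⟩
  (⁅ j ⁆ ++ ∅) ∪ (∅ ++ ⁅ j ⁆)     ≡⟨ zipWith-++ _∨_ ⁅ j ⁆ ∅ ∅ ⁅ j ⁆ ⟩
  (⁅ j ⁆ ∪ ∅) ++ (∅ ∪ ⁅ j ⁆)      ≡⟨ cong₂ _++_ (∪-identityʳ ⁅ j ⁆) (∪-identityˡ ⁅ j ⁆) ⟩
  twin j                          ∎)
  where open ≡-Reasoning

straddle : ∀ {M} (p q : Fin (M + M)) → toℕ q ≡ toℕ p + M → ∃[ j ] p ≡ j ↑ˡ M × q ≡ M ↑ʳ j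
straddle {M} p q q≡p+M = j , p≡j↑ˡM , sym M↑ʳj≡q
  where
    M≤q : M ≤ toℕ q
    M≤q = subst (M ≤_) (sym q≡p+M) (ℕ.m≤n+m M (toℕ p))
    j : Fin M
    j = Fin.reduce≥ q M≤q
    M↑ʳj≡q : M ↑ʳ j ≡ q
    M↑ʳj≡q = splitAt⁻¹-↑ʳ (splitAt-≥ M q M≤q)
    p≡j↑ˡM : p ≡ j ↑ˡ M
    p≡j↑ˡM = toℕ-injective (begin
      toℕ p        ≡⟨ ℕ.+-cancelʳ-≡ M (toℕ p) (toℕ j) (begin
        toℕ p + M      ≡⟨ q≡p+M ⟨
        toℕ q          ≡⟨ cong toℕ M↑ʳj≡q ⟨
        toℕ (M ↑ʳ j)   ≡⟨ toℕ-↑ʳ M j ⟩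
        M + toℕ j      ≡⟨ ℕ.+-comm M (toℕ j) ⟩
        toℕ j + M      ∎) ⟩
      toℕ j        ≡⟨ toℕ-↑ˡ j M ⟨
      toℕ (j ↑ˡ M) ∎)
      where open ≡-Reasoning

pairs⇔Twins : ∀ {M} {S : Subset (M + M)} →
              (∃[ p ] ∃[ q ] toℕ q ≡ toℕ p + M × S ≡ ⁅ p ⁆ ∪ ⁅ q ⁆) ⇔ Twins M S
pairs⇔Twins {M} = mk⇔ to from
  where
    to : ∀ {S} → (∃[ p ] ∃[ q ] toℕ q ≡ toℕ p + M × S ≡ ⁅ p ⁆ ∪ ⁅ q ⁆) → Twins M S
    to (p , q , q≡p+M , refl) with straddle {M} p q q≡p+M
    ... | j , refl , refl = j , sym (twin≡⁅j↑ˡM⁆∪⁅M↑ʳj⁆ j)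
    from : ∀ {S} → Twins M S → ∃[ p ] ∃[ q ] toℕ q ≡ toℕ p + M × S ≡ ⁅ p ⁆ ∪ ⁅ q ⁆
    from (j , refl) = j ↑ˡ M , M ↑ʳ j , M↑ʳj≡j↑ˡM+M , twin≡⁅j↑ˡM⁆∪⁅M↑ʳj⁆ j
      where
        M↑ʳj≡j↑ˡM+M : toℕ (M ↑ʳ j) ≡ toℕ (j ↑ˡ M) + M
        M↑ʳj≡j↑ˡM+M = trans (toℕ-↑ʳ M j) (trans (ℕ.+-comm M (toℕ j)) (cong (_+ M) (sym (toℕ-↑ˡ j M))))

-- In state wait c, c absent positions precede the second element of the pair.
module PairDFA (d : ℕ) where
  pattern scan   = Fin.zero
  pattern done   = Fin.suc Fin.zero
  pattern wait c = Fin.suc (Fin.suc c)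

  step : Fin (3 + d) → Bool → Maybe (Fin (3 + d))
  step scan              false = just scan
  step scan              true  = just (wait (Fin.fromℕ d))
  step done              false = just done
  step done              true  = nothing
  step (wait Fin.zero)    false = nothing
  step (wait Fin.zero)    true  = just done
  step (wait (Fin.suc c)) false = just (wait (Fin.inject₁ c))
  step (wait (Fin.suc c)) true  = nothing

  isDone : Fin (3 + d) → Bool
  isDone done = true
  isDone _    = false

  pairDFA : DFA (3 + d)
  pairDFA = record { start = scan ; δ = step ; accepting = isDone }

  open DFA pairDFA using (accepts)

  done⁺ : ∀ n → accepts (just done) (∅ {n}) ≡ true
  done⁺ zero    = refl
  done⁺ (suc n) = done⁺ n

  done⁻ : ∀ (V : Subset n) → accepts (just done) V ≡ true → V ≡ ∅
  done⁻ []          _      = refl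
  done⁻ (false ∷ V) accept = cong (false ∷_) (done⁻ V accept)

  wait⁺ : ∀ c (p : Fin n) → toℕ p ≡ toℕ c → accepts (just (wait c)) ⁅ p ⁆ ≡ true
  wait⁺ {suc n} Fin.zero Fin.zero _ = done⁺ n
  wait⁺ (Fin.suc c) (Fin.suc p) p≡c =
    wait⁺ (Fin.inject₁ c) p (trans (ℕ.suc-injective p≡c) (sym (toℕ-inject₁ c)))

  wait⁻ : ∀ c (V : Subset n) → accepts (just (wait c)) V ≡ true → ∃[ p ] toℕ p ≡ toℕ c × V ≡ ⁅ p ⁆
  wait⁻ Fin.zero    (true ∷ V)  accept = Fin.zero , refl , cong (true ∷_) (done⁻ V accept)
  wait⁻ (Fin.suc c) (false ∷ V) accept =
    let (p , p≡c , V≡⁅p⁆) = wait⁻ (Fin.inject₁ c) V accept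
    in Fin.suc p , cong suc (trans p≡c (toℕ-inject₁ c)) , cong (false ∷_) V≡⁅p⁆

  scan⁺ : ∀ (p q : Fin n) → toℕ q ≡ toℕ p + suc d → accepts (just scan) (⁅ p ⁆ ∪ ⁅ q ⁆) ≡ true
  scan⁺ Fin.zero    (Fin.suc q) q≡p+M =
    subst (λ V → accepts (just (wait (Fin.fromℕ d))) V ≡ true) (sym (∪-identityˡ ⁅ q ⁆))
      (wait⁺ (Fin.fromℕ d) q (trans (ℕ.suc-injective q≡p+M) (sym (toℕ-fromℕ d))))
  scan⁺ (Fin.suc p) (Fin.suc q) q≡p+M = scan⁺ p q (ℕ.suc-injective q≡p+M)

  scan⁻ : ∀ (V : Subset n) → accepts (just scan) V ≡ true →
          ∃[ p ] ∃[ q ] toℕ q ≡ toℕ p + suc d × V ≡ ⁅ p ⁆ ∪ ⁅ q ⁆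
  scan⁻ (false ∷ V) accept =
    let (p , q , q≡p+M , V≡) = scan⁻ V accept
    in Fin.suc p , Fin.suc q , cong suc q≡p+M , cong (false ∷_) V≡
  scan⁻ (true ∷ V)  accept =
    let (q , q≡d , V≡⁅q⁆) = wait⁻ (Fin.fromℕ d) V accept
    in Fin.zero , Fin.suc q , cong suc (trans q≡d (toℕ-fromℕ d)) ,
       cong (true ∷_) (trans V≡⁅q⁆ (sym (∪-identityˡ ⁅ q ⁆)))

  twins-recognizer : Recognizer (Twins (suc d)) (3 + d)
  twins-recognizer = record
    { dfa        = pairDFA
    ; few-states = ℕ.≤-refl
    ; language   = λ S → ⇔-trans (mk⇔ (scan⁻ S) λ { (p , q , q≡p+M , refl) → scan⁺ p q q≡p+M }) pairs⇔Twins }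

open PairDFA using (twins-recognizer)

powerSetDFA : DFA 1
powerSetDFA = record { start = Fin.zero ; δ = λ _ _ → just Fin.zero ; accepting = λ _ → true }

powerSet-recognizer : Recognizer {n} PowerSet 1
powerSet-recognizer = record
  { dfa = powerSetDFA ; few-states = ℕ.≤-refl ; language = λ S → mk⇔ _ (λ _ → accepts-all S) }
  where
    accepts-all : ∀ {n} (V : Subset n) → Language powerSetDFA V
    accepts-all []      = refl
    accepts-all (_ ∷ V) = accepts-all V

module SizeDFA (t : ℕ) where
  step : Fin (suc t) → Bool → Maybe (Fin (suc t))
  step c           false = just c
  step Fin.zero    true  = nothing
  step (Fin.suc c) true  = just (Fin.inject₁ c)

  isZero : Fin (suc t) → Bool
  isZero Fin.zero    = true
  isZero (Fin.suc _) = false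

  sizeDFA : DFA (suc t)
  sizeDFA = record { start = Fin.fromℕ t ; δ = step ; accepting = isZero }

  open DFA sizeDFA using (accepts)

  countdown⁺ : ∀ c (V : Subset n) → ∣ V ∣ ≡ toℕ c → accepts (just c) V ≡ true
  countdown⁺ Fin.zero    []          _       = refl
  countdown⁺ c           (false ∷ V) ∣V∣≡c   = countdown⁺ c V ∣V∣≡c
  countdown⁺ (Fin.suc c) (true ∷ V)  ∣V∣≡c   =
    countdown⁺ (Fin.inject₁ c) V (trans (ℕ.suc-injective ∣V∣≡c) (sym (toℕ-inject₁ c)))

  countdown⁻ : ∀ c (V : Subset n) → accepts (just c) V ≡ true → ∣ V ∣ ≡ toℕ c
  countdown⁻ Fin.zero    []          _      = refl
  countdown⁻ c           (false ∷ V) accept = countdown⁻ c V accept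
  countdown⁻ (Fin.suc c) (true ∷ V)  accept =
    cong suc (trans (countdown⁻ (Fin.inject₁ c) V accept) (toℕ-inject₁ c))

  ofSize-recognizer : Recognizer {n} (OfSize t) (suc t)
  ofSize-recognizer = record
    { dfa        = sizeDFA
    ; few-states = ℕ.≤-refl
    ; language   = λ S → mk⇔ (λ accept → trans (countdown⁻ _ S accept) (toℕ-fromℕ t))
                             (λ ∣S∣≡t → countdown⁺ _ S (trans ∣S∣≡t (sym (toℕ-fromℕ t)))) }

open SizeDFA using (ofSize-recognizer)

-- The operations evaluated on test sets

UpClosure : Family n → Family n
UpClosure F S = ∃[ A ] F A × A ⊆ S

module _ {F : Family n} {S : Subset n} where

  join-powerSet : apply join F PowerSet S ⇔ UpClosure F S
  join-powerSet = mk⇔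
    (λ { (A , B , FA , _ , S≡A∪B) → A , FA , subst (A ⊆_) (sym S≡A∪B) (p⊆p∪q B) })
    (λ { (A , FA , A⊆S) → A , S , FA , _ , sym (p⊆q⇒p∪q≡q A⊆S) })

  disjointJoin-powerSet : apply disjointJoin F PowerSet S ⇔ UpClosure F S
  disjointJoin-powerSet = mk⇔
    (λ { (A , B , FA , _ , _ , S≡A∪B) → A , FA , subst (A ⊆_) (sym S≡A∪B) (p⊆p∪q B) })
    (λ { (A , FA , A⊆S) → A , S ─ A , FA , _ , p∩[q─p]≡∅ A S , sym (p⊆q⇒p∪[q─p]≡q A⊆S) })

  jointJoin-powerSet : (∀ {A} → F A → Nonempty A) → apply jointJoin F PowerSet S ⇔ UpClosure F S
  jointJoin-powerSet nonempty = mk⇔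
    (λ { (A , B , FA , _ , _ , S≡A∪B) → A , FA , subst (A ⊆_) (sym S≡A∪B) (p⊆p∪q B) })
    (λ { (A , FA , A⊆S) → A , S , FA , _ , meets FA A⊆S , sym (p⊆q⇒p∪q≡q A⊆S) })
    where
      meets : ∀ {A} → F A → A ⊆ S → A ∩ S ≢ ∅
      meets FA A⊆S A∩S≡∅ =
        let (x , x∈A) = nonempty FA
        in ∉⊥ (subst (x ∈_) A∩S≡∅ (x∈p∩q⁺ (x∈A , A⊆S x∈A)))

  meet-powerSet : apply meet (F ∘ ∁) PowerSet S ⇔ UpClosure F (∁ S)
  meet-powerSet = mk⇔
    (λ { (A , B , F∁A , _ , S≡A∩B) → ∁ A , F∁A , p⊆q⇒∁p⊇∁q (subst (_⊆ A) (sym S≡A∩B) (p∩q⊆p A B)) })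
    (λ { (A , FA , A⊆∁S) → ∁ A , S , subst F (sym (∁-involutive A)) FA , _ ,
                           sym (trans (∩-comm (∁ A) S) (p⊆q⇒p∩q≡p (S⊆∁A A⊆∁S))) })
    where
      S⊆∁A : ∀ {A} → A ⊆ ∁ S → S ⊆ ∁ A
      S⊆∁A A⊆∁S = subst (_⊆ ∁ _) (∁-involutive S) (p⊆q⇒∁p⊇∁q A⊆∁S)

  delta-ofSize : ∀ {k t} → (∀ {A} → F A → ∣ A ∣ ≡ k) → ∣ S ∣ ≡ t + k →
                 apply delta F (OfSize t) S ⇔ UpClosure F S
  delta-ofSize {k} {t} ∣F∣≡k ∣S∣≡t+k = mk⇔
    (λ { (A , B , FA , ∣B∣≡t , S≡A⊕B) →
         let ∣A⊕S∣≡t = trans (cong ∣_∣ (sym (B≡A⊕S S≡A⊕B))) ∣B∣≡t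
             ∣A∩S∣≡k = halve (trans (cong (_+ 2 * ∣ A ∩ S ∣) (sym ∣A⊕S∣≡t)) (count FA))
         in A , FA , ∣p∩q∣≡∣p∣⇒p⊆q A S (trans ∣A∩S∣≡k (sym (∣F∣≡k FA))) })
    (λ { (A , FA , A⊆S) →
         let ∣A∩S∣≡k = trans (cong ∣_∣ (p⊆q⇒p∩q≡p A⊆S)) (∣F∣≡k FA)
         in A , A ⊕ S , FA , cancel (trans (cong (λ c → ∣ A ⊕ S ∣ + 2 * c) (sym ∣A∩S∣≡k)) (count FA)) ,
            sym (⊕-cancelˡ A S) })
    where
      count : ∀ {A} → F A → ∣ A ⊕ S ∣ + 2 * ∣ A ∩ S ∣ ≡ k + (t + k)
      count {A} FA = trans (∣p⊕q∣+2∣p∩q∣≡∣p∣+∣q∣ A S) (cong₂ _+_ (∣F∣≡k FA) ∣S∣≡t+k)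
      B≡A⊕S : ∀ {A B} → S ≡ A ⊕ B → B ≡ A ⊕ S
      B≡A⊕S {A} {B} S≡A⊕B = trans (sym (⊕-cancelˡ A B)) (cong (A ⊕_) (sym S≡A⊕B))
      k+[t+k]≡t+2k : ∀ t k → k + (t + k) ≡ t + 2 * k
      k+[t+k]≡t+2k = solve-∀
      cancel : ∀ {x} → x + 2 * k ≡ k + (t + k) → x ≡ t
      cancel {x} eq = ℕ.+-cancelʳ-≡ (2 * k) x t (trans eq (k+[t+k]≡t+2k t k))
      halve : ∀ {y} → t + 2 * y ≡ k + (t + k) → y ≡ k
      halve {y} eq = ℕ.*-cancelˡ-≡ y k 2 (ℕ.+-cancelˡ-≡ t (2 * y) (2 * k) (trans eq (k+[t+k]≡t+2k t k)))

twin-nonempty : ∀ {M} {A : Subset (M + M)} → Twins M A → Nonempty A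
twin-nonempty {M} (j , refl) = j ↑ˡ M , Equivalence.from x↑ˡ∈p++q⇔x∈p (x∈⁅x⁆ j)

∣twin∣≡2 : ∀ {M} {A : Subset (M + M)} → Twins M A → ∣ A ∣ ≡ 2
∣twin∣≡2 (j , refl) = trans (∣p++q∣≡∣p∣+∣q∣ ⁅ j ⁆ ⁅ j ⁆) (cong₂ _+_ (∣⁅x⁆∣≡1 j) (∣⁅x⁆∣≡1 j))

module Probes (m : ℕ) where

  -- ∁ a makes ∣ test a i ∣ independent of a, as the delta case needs.
  test : Subset m → Fin m → Subset ((m + m) + (m + m))
  test a i = (a ++ ∁ a) ++ ⁅ i ↑ˡ m ⁆

  twin⊆test⇔ : ∀ a i → UpClosure (Twins (m + m)) (test a i) ⇔ i ∈ a
  twin⊆test⇔ a i = mk⇔ to from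
    where
      to : UpClosure (Twins (m + m)) (test a i) → i ∈ a
      to (_ , (j , refl) , twin⊆test) =
        let (⁅j⁆⊆a++∁a , ⁅j⁆⊆⁅i⁆) = ++-⊆⁻ {p = ⁅ j ⁆} twin⊆test
            j≡i = x∈⁅y⁆⇒x≡y (i ↑ˡ m) (Equivalence.to ⁅x⁆⊆p⇔x∈p ⁅j⁆⊆⁅i⁆)
        in Equivalence.to x↑ˡ∈p++q⇔x∈p (subst (_∈ a ++ ∁ a) j≡i (Equivalence.to ⁅x⁆⊆p⇔x∈p ⁅j⁆⊆a++∁a))
      from : i ∈ a → UpClosure (Twins (m + m)) (test a i)
      from i∈a = twin (i ↑ˡ m) , (i ↑ˡ m , refl) , ++-⊆⁺ ⁅i⁆⊆a++∁a id
        where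
          ⁅i⁆⊆a++∁a : ⁅ i ↑ˡ m ⁆ ⊆ a ++ ∁ a
          ⁅i⁆⊆a++∁a = Equivalence.from ⁅x⁆⊆p⇔x∈p (Equivalence.from x↑ˡ∈p++q⇔x∈p i∈a)

  ∣test∣ : ∀ a i → ∣ test a i ∣ ≡ m + 1
  ∣test∣ a i = begin
    ∣ test a i ∣                        ≡⟨ ∣p++q∣≡∣p∣+∣q∣ (a ++ ∁ a) ⁅ i ↑ˡ m ⁆ ⟩
    ∣ a ++ ∁ a ∣ + ∣ ⁅ i ↑ˡ m ⁆ ∣       ≡⟨ cong₂ _+_ (∣p++q∣≡∣p∣+∣q∣ a (∁ a)) (∣⁅x⁆∣≡1 (i ↑ˡ m)) ⟩
    (∣ a ∣ + ∣ ∁ a ∣) + 1               ≡⟨ cong (_+ 1) (∣p∣+∣∁p∣≡n a) ⟩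
    m + 1                               ∎
    where open ≡-Reasoning

-- Families and bounds for each operation

ground : ℕ → ℕ
ground m = (m + m) + (m + m)

leftFamily : Op → (m : ℕ) → Family (ground m)
leftFamily meet m = Twins (m + m) ∘ ∁
leftFamily _    m = Twins (m + m)

rightFamily : Op → (m : ℕ) → Family (ground m)
rightFamily delta m = OfSize (pred m)
rightFamily _     m = PowerSet

prefix : Op → Subset m → Subset (m + m)
prefix meet a = ∁ (a ++ ∁ a)
prefix _    a = a ++ ∁ a

probe : ∀ {m} → Op → Fin m → Subset (m + m)
probe {m} meet i = ∁ ⁅ i ↑ˡ m ⁆
probe {m} _    i = ⁅ i ↑ˡ m ⁆

probe-correct : ∀ op {t} (a : Subset (suc t)) i →
  apply op (leftFamily op (suc t)) (rightFamily op (suc t)) (prefix op a ++ probe op i) ⇔ i ∈ a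
probe-correct join         a i = ⇔-trans join-powerSet (twin⊆test⇔ a i) where open Probes _
probe-correct disjointJoin a i = ⇔-trans disjointJoin-powerSet (twin⊆test⇔ a i) where open Probes _
probe-correct jointJoin    a i = ⇔-trans (jointJoin-powerSet twin-nonempty) (twin⊆test⇔ a i) where open Probes _
probe-correct delta {t}    a i =
  ⇔-trans (delta-ofSize ∣twin∣≡2 (trans (∣test∣ a i) (sym (ℕ.+-suc t 1)))) (twin⊆test⇔ a i)
  where open Probes _
probe-correct meet         a i = begin
  apply meet (Twins _ ∘ ∁) PowerSet (∁ (a ++ ∁ a) ++ ∁ ⁅ i ↑ˡ _ ⁆)
    ≡⟨ cong (apply meet _ _) (map-++ not (a ++ ∁ a) _) ⟨
  apply meet (Twins _ ∘ ∁) PowerSet (∁ (test a i))  ≈⟨ meet-powerSet ⟩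
  UpClosure (Twins _) (∁ (∁ (test a i)))            ≡⟨ cong (UpClosure _) (∁-involutive (test a i)) ⟩
  UpClosure (Twins _) (test a i)                    ≈⟨ twin⊆test⇔ a i ⟩
  i ∈ a                                             ∎
  where
    open Probes _
    open SetoidReasoning (⇔-setoid 0ℓ)

left-recognizer : ∀ op t → Recognizer (leftFamily op (suc t)) (2 + (suc t + suc t))
left-recognizer meet         t = complement-recognizer (twins-recognizer (t + suc t))
left-recognizer join         t = twins-recognizer (t + suc t)
left-recognizer disjointJoin t = twins-recognizer (t + suc t)
left-recognizer jointJoin    t = twins-recognizer (t + suc t)
left-recognizer delta        t = twins-recognizer (t + suc t)

right-recognizer : ∀ op t → Recognizer (rightFamily op (suc t)) (2 + (suc t + suc t))
right-recognizer delta        t = Recognizer-weaken (ℕ.≤-trans (ℕ.m≤m+n (suc t) (suc t)) (ℕ.m≤n+m _ 2))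
                                                    (ofSize-recognizer t)
right-recognizer join         t = Recognizer-weaken (s≤s z≤n) powerSet-recognizer
right-recognizer disjointJoin t = Recognizer-weaken (s≤s z≤n) powerSet-recognizer
right-recognizer jointJoin    t = Recognizer-weaken (s≤s z≤n) powerSet-recognizer
right-recognizer meet         t = Recognizer-weaken (s≤s z≤n) powerSet-recognizer

quadratic≤cubic : ∀ t → let n = ground (suc t) ; s = 2 + (suc t + suc t) in
                  (n * s + 2) + (n * s + 2) ≤ 36 * suc t ^ 3
quadratic≤cubic t = ℕ.≤-trans (ℕ.m≤m+n _ (4 * t * (9 * t * t + 23 * t + 15))) (ℕ.≤-reflexive (expand t))
  where
    expand : ∀ x → let m = 1 + x ; n = (m + m) + (m + m) in
             (n * (2 + (m + m)) + 2) + (n * (2 + (m + m)) + 2) + 4 * x * (9 * x * x + 23 * x + 15)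
               ≡ 36 * (m * (m * (m * 1)))
    expand = solve-∀

small-zdds : ∀ op t → ∃[ DF ] ∃[ DG ] (Represents DF (leftFamily op (suc t))
                                       × Represents DG (rightFamily op (suc t))
                                       × size DF + size DG ≤ 36 * suc t ^ 3)
small-zdds op t =
  let (DF , DF-represents , DF-size) = recognizer⇒zdd (left-recognizer op t)
      (DG , DG-represents , DG-size) = recognizer⇒zdd (right-recognizer op t)
  in DF , DG , DF-represents , DG-represents , ℕ.≤-trans (ℕ.+-mono-≤ DF-size DG-size) (quadratic≤cubic t)

large-zdd : ∀ op t (D : ZDD (ground (suc t))) →
            Represents D (apply op (leftFamily op (suc t)) (rightFamily op (suc t))) →
            2 ^ (suc t / 5) ≤ 1 * suc t * size D
large-zdd op t D D-represents = begin
  2 ^ (suc t / 5)      ≤⟨ ℕ.^-monoʳ-≤ 2 (m/n≤m (suc t) 5) ⟩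
  2 ^ suc t            ≤⟨ fooling-set-bound D D-represents (prefix op) (probe op) (probe-correct op) ⟩
  size D               ≤⟨ ℕ.m≤n*m (size D) (suc t) ⟩
  suc t * size D       ≡⟨ cong (_* size D) (ℕ.*-identityˡ (suc t)) ⟨
  1 * suc t * size D   ∎
  where open ℕ.≤-Reasoning

theorem7 : (op : Op) →
    Σ (ℕ → ℕ) λ u →
    Σ ((m : ℕ) → Family (u m)) λ F →
    Σ ((m : ℕ) → Family (u m)) λ G →
      (∃[ c ] ∃[ m₀ ] ∀ m → m₀ ≤ m → u m ≤ c * m)
      × (∃[ c ] ∃[ m₀ ] ∀ m → m₀ ≤ m →
           ∃[ DF ] ∃[ DG ] (Represents DF (F m) × Represents DG (G m)
                            × size DF + size DG ≤ c * m ^ 3))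
      × (∃[ c ] ∃[ m₀ ] ∀ m → m₀ ≤ m →
           ∀ (D : ZDD (u m)) → Represents D (apply op (F m) (G m)) →
             2 ^ (m / 5) ≤ c * m * size D)
theorem7 op =
  ground , leftFamily op , rightFamily op ,
  (4 , 0 , λ m _ → ℕ.≤-reflexive (ground≡4m m)) ,
  (36 , 1 , λ { (suc t) _ → small-zdds op t }) ,
  (1 , 1 , λ { (suc t) _ → large-zdd op t })
  where
    ground≡4m : ∀ m → (m + m) + (m + m) ≡ 4 * m
    ground≡4m = solve-∀
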